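{- Let $k\geq 5$ and $l\geq 1$ be integers, and let $G$ be a 4-critical graph with $L(G)=\{k,k+2l\}$. Then any two cycles of length $k+2l$ in $G$ have at least two vertices in common.
   Context: All graphs are finite and simple. $L(G)$ is the set of all lengths of odd cycles contained in $G$. A graph $G$ is 4-critical if $\chi(G)=4$ and every proper subgraph of $G$ has chromatic number less than 4. -}

module Defs where

open import Level using (0ℓ)
open import Data.Nat using (ℕ; zero; suc; _+_; _*_; _<_; _≤_)
open import Data.Fin using (Fin; zero; suc; inject₁; fromℕ)
open import Data.Product using (Σ; ∃; _×_; _,_)
open import Data.Sum using (_⊎_)
open import Relation.Binary.PropositionalEquality using (_≡_; _≢_)
open import Relation.Nullary using (¬_)
open import Function.Definitions using (Injective)

record Graph : Set₁ where
  field
    n    : ℕ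
    Adj  : Fin n → Fin n → Set
    sym  : ∀ {u v} → Adj u v → Adj v u
    irr  : ∀ {u} → ¬ Adj u u
open Graph public

record Subgraph (G : Graph) : Set₁ where
  field
    V'     : Fin (n G) → Set
    E'     : Fin (n G) → Fin (n G) → Set
    E'sym  : ∀ {u v} → E' u v → E' v u
    E'⊆E   : ∀ {u v} → E' u v → Adj G u v
    E'ends : ∀ {u v} → E' u v → V' u × V' v
open Subgraph public

full : (G : Graph) → Subgraph G
full G = record
  { V' = λ _ → Data.Unit.⊤ ; E' = Adj G ; E'sym = sym G ; E'⊆E = λ e → e
  ; E'ends = λ _ → _ , _ }
  where import Data.Unit

Proper : {G : Graph} → Subgraph G → Set
Proper {G} H = (∃ λ v → ¬ V' H v) ⊎ (∃ λ u → ∃ λ v → Adj G u v × ¬ E' H u v)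

-- Proper colouring of a subgraph with c colours (colours of vertices outside
-- V' are irrelevant).
Colorable : {G : Graph} → Subgraph G → ℕ → Set
Colorable {G} H c = Σ (Fin (n G) → Fin c) λ col →
  ∀ {u v} → E' H u v → col u ≢ col v

ChromaticNumber : {G : Graph} → Subgraph G → ℕ → Set
ChromaticNumber H m = Colorable H m × (∀ c → c < m → ¬ Colorable H c)

ChromaticLess : {G : Graph} → Subgraph G → ℕ → Set
ChromaticLess H m = ∃ λ c → c < m × Colorable H c

FourCritical : Graph → Set₁
FourCritical G = ChromaticNumber (full G) 4 ×
  ((H : Subgraph G) → Proper H → ChromaticLess H 4)

record Cycle (G : Graph) (len : ℕ) : Set where
  field
    p        : ℕ
    len≡     : len ≡ suc p
    len≥3    : 3 ≤ len
    vtx      : Fin (suc p) → Fin (n G)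
    inj      : Injective _≡_ _≡_ vtx
    step     : (i : Fin p) → Adj G (vtx (inject₁ i)) (vtx (suc i))
    close    : Adj G (vtx (fromℕ p)) (vtx zero)
open Cycle public

OnCycle : {G : Graph} {len : ℕ} → Cycle G len → Fin (n G) → Set
OnCycle C v = ∃ λ i → vtx C i ≡ v

Odd : ℕ → Set
Odd m = ∃ λ t → m ≡ suc (2 * t)

InL : Graph → ℕ → Set
InL G m = Odd m × Cycle G m

module Submission where

-- Only two properties of G are used:
-- L is its largest odd cycle length, and G has no cut vertex (4-criticality:
-- 3-colourings of the two sides of a cut vertex would glue together).
--
-- Suppose two L-cycles C₁, C₂ share at most one vertex.  A fan argument
-- (Menger's theorem for two paths) yields two disjoint paths P, Q from C₂ to
-- C₁ meeting the cycles only at their ends (P is trivial if the cycles share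
-- a vertex).  The ends of P and Q cut C₁ into arcs α, β and C₂ into arcs γ, δ;
-- of the four cycles formed by P, Q and one arc of each cycle, two have odd
-- length and together are longer than 2L (crossing-parity), a contradiction.
--
-- Since the
-- conclusion is decidable, connectivity is only needed under double negation.

open import Defs
open import Data.Nat using (ℕ; _+_; _*_; _≤_)
open import Data.Fin using (Fin)
open import Data.Product using (∃; _×_)
open import Data.Sum using (_⊎_)
open import Relation.Binary.PropositionalEquality using (_≡_; _≢_)

open import Level using (0ℓ)
open import Function using (_∘_)
open import Data.Nat using (zero; suc; s≤s; z≤n)
open import Data.Nat.Properties using (module ≤-Reasoning; ≤-trans; ≤-refl; +-mono-≤; m≤n+m; m≤m+n; n≤1+n; 1+n≰n; +-monoˡ-≤; *-monoʳ-≤; even≢odd; +-comm)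
open import Data.Nat.Tactic.RingSolver using (solve-∀)
open import Data.Fin using (zero; suc; inject₁; inject≤; fromℕ; fromℕ<; toℕ) renaming (_≟_ to _≟ᶠ_)
open import Data.Fin.Properties using (any?; toℕ-fromℕ<; inject≤-injective)
open import Data.Fin.Permutation.Components using (transpose; transpose-inverse)
open import Data.Product using (Σ; _,_; proj₁; proj₂; swap)
open import Data.Sum using (inj₁; inj₂; [_,_]′)
open import Data.Empty using (⊥; ⊥-elim)
open import Data.List using (List; []; _∷_; _++_; tabulate)
open import Data.List.Membership.Propositional using (_∈_; _∉_)
open import Data.List.Membership.Propositional.Properties using (∈-++⁺ˡ; ∈-++⁺ʳ; ∈-++⁻; ∈-tabulate⁺; ∈-tabulate⁻)
import Data.List.Membership.DecPropositional as DecMembership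
open import Data.List.Relation.Unary.Any using (Any; here; there)
import Data.List.Relation.Unary.Any as Any
open import Data.List.Relation.Unary.All using ([])
import Data.List.Relation.Unary.All.Properties as All
open import Data.List.Relation.Unary.Unique.Propositional using (Unique; []; _∷_)
import Data.List.Relation.Unary.Unique.Propositional.Properties as Unique
open import Data.List.Relation.Binary.Disjoint.Propositional using (Disjoint)
open import Data.List.Relation.Binary.Subset.Propositional using (_⊆_)
open import Relation.Binary.PropositionalEquality as ≡ using (refl; cong; cong₂; subst; subst₂; trans)
open import Relation.Nullary using (¬_; Dec; yes; no; ¬?)
open import Relation.Nullary.Decidable using (dec-true) renaming (_×-dec_ to _×?_; _⊎-dec_ to _⊎?_)
open import Relation.Nullary.Decidable.Core using (¬¬-excluded-middle)
open import Relation.Nullary.Negation using (¬¬-Monad)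
open import Relation.Unary using (Decidable)
open import Effect.Monad using (RawMonad)

open RawMonad (¬¬-Monad {0ℓ}) using (_>>=_; pure)

-- Double negation commutes with quantification over a finite type.  This
-- lets us use "every vertex is or is not in R" when proving a negated goal.
¬¬-∀-Fin : ∀ m {P : Fin m → Set} → (∀ i → ¬ ¬ P i) → ¬ ¬ (∀ i → P i)
¬¬-∀-Fin zero    f = pure λ ()
¬¬-∀-Fin (suc m) f =
  f zero >>= λ p₀ → ¬¬-∀-Fin m (f ∘ suc) >>= λ ps →
  pure λ { zero → p₀ ; (suc i) → ps i }

another : ∀ {m} {P : Fin m → Set} {u v} → u ≢ v → P u → P v → ∀ x → Σ (Fin m) λ w → P w × w ≢ x
another {u = u} {v} u≢v Pu Pv x with u ≟ᶠ x
... | yes refl = v , Pv , u≢v ∘ ≡.sym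
... | no u≢x   = u , Pu , u≢x

module _ {A : Set} where

  unique-∷ : ∀ {x : A} {xs} → x ∉ xs → Unique xs → Unique (x ∷ xs)
  unique-∷ {xs = xs} x∉xs u = All.¬Any⇒All¬ xs x∉xs ∷ u

  unique-head : ∀ {x : A} {xs} → Unique (x ∷ xs) → x ∉ xs
  unique-head (x≢xs ∷ _) = All.All¬⇒¬Any x≢xs

  unique-++⁻ˡ : ∀ (xs : List A) {ys} → Unique (xs ++ ys) → Unique xs
  unique-++⁻ˡ []       _          = []
  unique-++⁻ˡ (x ∷ xs) (x≢xs ∷ u) = All.++⁻ˡ xs x≢xs ∷ unique-++⁻ˡ xs u

  unique-++⁻ʳ : ∀ (xs : List A) {ys} → Unique (xs ++ ys) → Unique ys
  unique-++⁻ʳ []       u       = u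
  unique-++⁻ʳ (x ∷ xs) (_ ∷ u) = unique-++⁻ʳ xs u

  unique-++⁻-disjoint : ∀ (xs : List A) {ys} → Unique (xs ++ ys) → Disjoint xs ys
  unique-++⁻-disjoint (x ∷ xs) (x≢ ∷ _) (here refl , v∈ys) = All.All¬⇒¬Any (All.++⁻ʳ xs x≢) v∈ys
  unique-++⁻-disjoint (x ∷ xs) (_ ∷ u)  (there v∈xs , v∈ys) = unique-++⁻-disjoint xs u (v∈xs , v∈ys)

  unique-++-comm : ∀ (xs : List A) {ys} → Unique (xs ++ ys) → Unique (ys ++ xs)
  unique-++-comm xs u =
    Unique.++⁺ (unique-++⁻ʳ xs u) (unique-++⁻ˡ xs u) (unique-++⁻-disjoint xs u ∘ swap)

  ∈-++-comm : ∀ (xs : List A) {ys} → xs ++ ys ⊆ ys ++ xs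
  ∈-++-comm xs {ys} m = [ ∈-++⁺ʳ ys , ∈-++⁺ˡ ]′ (∈-++⁻ xs m)

Even : ℕ → Set
Even m = ∃ λ t → m ≡ 2 * t

parity : ∀ m → Even m ⊎ Odd m
parity zero = inj₁ (0 , refl)
parity (suc m) with parity m
... | inj₁ (t , m≡2t)   = inj₂ (t , cong suc m≡2t)
... | inj₂ (t , m≡2t+1) = inj₁ (suc t , trans (cong suc m≡2t+1) (twice-suc t))
  where
  twice-suc : ∀ t → suc (suc (2 * t)) ≡ 2 * suc t
  twice-suc = solve-∀

odd-partner : ∀ {x y} K → x + y ≡ 2 * K → Odd x → Odd y
odd-partner {x} {y} K x+y≡2K (a , x≡2a+1) with parity y
... | inj₂ odd = odd
... | inj₁ (b , y≡2b) =
  ⊥-elim (even≢odd K (a + b) (trans (≡.sym x+y≡2K) (trans (cong₂ _+_ x≡2a+1 y≡2b) (regroup a b))))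
  where
  regroup : ∀ a b → suc (2 * a) + 2 * b ≡ suc (2 * (a + b))
  regroup = solve-∀

odd-summand : ∀ {x y} K → x + y ≡ suc (2 * K) → Odd x ⊎ Odd y
odd-summand {x} {y} K x+y≡2K+1 with parity x | parity y
... | inj₂ odd | _ = inj₁ odd
... | _ | inj₂ odd = inj₂ odd
... | inj₁ (a , x≡2a) | inj₁ (b , y≡2b) =
  ⊥-elim (even≢odd (a + b) K (trans (≡.sym (regroup a b)) (trans (≡.sym (cong₂ _+_ x≡2a y≡2b)) x+y≡2K+1)))
  where
  regroup : ∀ a b → 2 * a + 2 * b ≡ 2 * (a + b)
  regroup = solve-∀

-- "An odd number x is at most L": the constraint every odd cycle length
-- satisfies when L is the longest odd cycle length.
OddAtMost : ℕ → ℕ → Set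
OddAtMost L x = Odd x → x ≤ L

opposite-sum : ∀ s α β γ δ {L} → α + β ≡ L → γ + δ ≡ L →
  s + (α + δ) + (s + (β + γ)) ≡ 2 * (s + L)
opposite-sum s α β γ δ {L} α+β≡L γ+δ≡L =
  trans (regroup s α β γ δ) (trans (cong₂ (λ u v → 2 * s + u + v) α+β≡L γ+δ≡L) (double s L))
  where
  regroup : ∀ s α β γ δ → s + (α + δ) + (s + (β + γ)) ≡ 2 * s + (α + β) + (γ + δ)
  regroup = solve-∀
  double : ∀ s L → 2 * s + L + L ≡ 2 * (s + L)
  double = solve-∀

adjacent-sum : ∀ s α γ δ t → γ + δ ≡ suc (2 * t) →
  s + (α + δ) + (s + (α + γ)) ≡ suc (2 * (s + α + t))
adjacent-sum s α γ δ t γ+δ≡2t+1 =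
  trans (regroup s α γ δ) (trans (cong (2 * (s + α) +_) γ+δ≡2t+1) (collect s α t))
  where
  regroup : ∀ s α γ δ → s + (α + δ) + (s + (α + γ)) ≡ 2 * (s + α) + (γ + δ)
  regroup = solve-∀
  collect : ∀ s α t → 2 * (s + α) + suc (2 * t) ≡ suc (2 * (s + α + t))
  collect = solve-∀

sum-too-large : ∀ s L {x y} → 1 ≤ s → x + y ≡ 2 * (s + L) → x ≤ L → y ≤ L → ⊥
sum-too-large s L {x} {y} 1≤s x+y≡2[s+L] x≤L y≤L = 1+n≰n (begin
  suc (L + L)        ≤⟨ n≤1+n _ ⟩
  suc (suc (L + L))  ≡⟨ double-suc L ⟩
  2 * (1 + L)        ≤⟨ *-monoʳ-≤ 2 (+-monoˡ-≤ L 1≤s) ⟩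
  2 * (s + L)        ≡⟨ ≡.sym x+y≡2[s+L] ⟩
  x + y              ≤⟨ +-mono-≤ x≤L y≤L ⟩
  L + L              ∎)
  where
  open ≤-Reasoning
  double-suc : ∀ L → suc (suc (L + L)) ≡ 2 * (1 + L)
  double-suc = solve-∀

-- Two cycles of lengths α + β = L and
-- γ + δ = L (L odd), joined by two disjoint paths of total length s ≥ 1,
-- yield four crossing closed walks of lengths s + (α + δ), s + (β + γ),
-- s + (α + γ), s + (β + δ).  Opposite ones sum to 2(s + L) while adjacent
-- ones sum to an odd number, so some opposite pair consists of two odd
-- numbers whose sum exceeds 2L: they cannot both be at most L.
crossing-parity : ∀ s α β γ δ L → Odd L → 1 ≤ s → α + β ≡ L → γ + δ ≡ L →
  OddAtMost L (s + (α + δ)) → OddAtMost L (s + (β + γ)) →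
  OddAtMost L (s + (α + γ)) → OddAtMost L (s + (β + δ)) → ⊥
crossing-parity s α β γ δ L (t , L≡2t+1) 1≤s α+β≡L γ+δ≡L bαδ bβγ bαγ bβδ
  with odd-summand (s + α + t) (adjacent-sum s α γ δ t (trans γ+δ≡L L≡2t+1))
... | inj₁ oddαδ = sum-too-large s L 1≤s sum (bαδ oddαδ) (bβγ (odd-partner (s + L) sum oddαδ))
  where
  sum : s + (α + δ) + (s + (β + γ)) ≡ 2 * (s + L)
  sum = opposite-sum s α β γ δ α+β≡L γ+δ≡L
... | inj₂ oddαγ = sum-too-large s L 1≤s sum (bαγ oddαγ) (bβδ (odd-partner (s + L) sum oddαγ))
  where
  sum : s + (α + γ) + (s + (β + δ)) ≡ 2 * (s + L)
  sum = opposite-sum s α β δ γ α+β≡L (trans (+-comm δ γ) γ+δ≡L)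

module Walks (G : Graph) where

  V : Set
  V = Fin (n G)

  data Walk : V → V → Set where
    [_]    : (a : V) → Walk a a
    _∷⟨_⟩_ : (a : V) {b c : V} → Adj G a b → Walk b c → Walk a c

  infixr 5 _∷⟨_⟩_

  verts : ∀ {a b} → Walk a b → List V
  verts [ a ]         = a ∷ []
  verts (a ∷⟨ _ ⟩ W) = a ∷ verts W

  -- All vertices but the first.  For a closed walk this lists every visit
  -- exactly once, so a closed walk is a cycle when its tverts are distinct.
  tverts : ∀ {a b} → Walk a b → List V
  tverts [ _ ]         = []
  tverts (_ ∷⟨ _ ⟩ W) = verts W

  len : ∀ {a b} → Walk a b → ℕ
  len [ _ ]         = 0
  len (_ ∷⟨ _ ⟩ W) = suc (len W)

  _∈?_ : (v : V) (xs : List V) → Dec (v ∈ xs)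
  _∈?_ = DecMembership._∈?_ _≟ᶠ_

  IsPath : ∀ {a b} → Walk a b → Set
  IsPath W = Unique (verts W)

  PathIn : ∀ {a b} → (V → Set) → Walk a b → Set
  PathIn U W = IsPath W × (∀ {v} → v ∈ verts W → U v)

  Avoids : ∀ {a b} → Walk a b → V → Set
  Avoids W x = ∀ {v} → v ∈ verts W → v ≢ x

  verts≡ : ∀ {a b} (W : Walk a b) → verts W ≡ a ∷ tverts W
  verts≡ [ a ]         = refl
  verts≡ (a ∷⟨ _ ⟩ W) = refl

  start∈ : ∀ {a b} (W : Walk a b) → a ∈ verts W
  start∈ [ a ]         = here refl
  start∈ (a ∷⟨ _ ⟩ W) = here refl

  end∈ : ∀ {a b} (W : Walk a b) → b ∈ verts W
  end∈ [ a ]         = here refl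
  end∈ (a ∷⟨ _ ⟩ W) = there (end∈ W)

  end∈tverts : ∀ {a b} (W : Walk a b) → a ≢ b → b ∈ tverts W
  end∈tverts [ a ]         a≢a = ⊥-elim (a≢a refl)
  end∈tverts (a ∷⟨ _ ⟩ W) _   = end∈ W

  tverts⊆verts : ∀ {a b} (W : Walk a b) → tverts W ⊆ verts W
  tverts⊆verts (a ∷⟨ _ ⟩ W) = there

  len-positive : ∀ {a b} → a ≢ b → (W : Walk a b) → 1 ≤ len W
  len-positive a≢a [ a ]         = ⊥-elim (a≢a refl)
  len-positive _   (a ∷⟨ _ ⟩ W) = s≤s z≤n

  path-start∉tverts : ∀ {a b} (W : Walk a b) → IsPath W → a ∉ tverts W
  path-start∉tverts (a ∷⟨ _ ⟩ W) u = unique-head u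

  path-tverts : ∀ {a b} (W : Walk a b) → IsPath W → Unique (tverts W)
  path-tverts [ a ]         _       = []
  path-tverts (a ∷⟨ _ ⟩ W) (_ ∷ u) = u

  _++ʷ_ : ∀ {a b c} → Walk a b → Walk b c → Walk a c
  [ a ]         ++ʷ Y = Y
  (a ∷⟨ e ⟩ X) ++ʷ Y = a ∷⟨ e ⟩ (X ++ʷ Y)

  infixr 5 _++ʷ_

  verts-++ʷ : ∀ {a b c} (X : Walk a b) (Y : Walk b c) → verts (X ++ʷ Y) ≡ verts X ++ tverts Y
  verts-++ʷ [ a ]         Y = verts≡ Y
  verts-++ʷ (a ∷⟨ _ ⟩ X) Y = cong (a ∷_) (verts-++ʷ X Y)

  tverts-++ʷ : ∀ {a b c} (X : Walk a b) (Y : Walk b c) → tverts (X ++ʷ Y) ≡ tverts X ++ tverts Y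
  tverts-++ʷ [ a ]         Y = refl
  tverts-++ʷ (a ∷⟨ _ ⟩ X) Y = verts-++ʷ X Y

  len-++ʷ : ∀ {a b c} (X : Walk a b) (Y : Walk b c) → len (X ++ʷ Y) ≡ len X + len Y
  len-++ʷ [ a ]         Y = refl
  len-++ʷ (a ∷⟨ _ ⟩ X) Y = cong suc (len-++ʷ X Y)

  reverse : ∀ {a b} → Walk a b → Walk b a
  reverse [ a ]         = [ a ]
  reverse (a ∷⟨ e ⟩ W) = reverse W ++ʷ (_ ∷⟨ sym G e ⟩ [ a ])

  len-reverse : ∀ {a b} (W : Walk a b) → len (reverse W) ≡ len W
  len-reverse [ a ]         = refl
  len-reverse (a ∷⟨ _ ⟩ W) =
    trans (len-++ʷ (reverse W) _) (trans (+-comm (len (reverse W)) 1) (cong suc (len-reverse W)))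

  verts-reverse : ∀ {a b} (W : Walk a b) → verts (reverse W) ⊆ verts W
  verts-reverse [ a ]         m = m
  verts-reverse (a ∷⟨ _ ⟩ W) m
    with ∈-++⁻ (verts (reverse W)) (subst (_ ∈_) (verts-++ʷ (reverse W) _) m)
  ... | inj₁ m′        = there (verts-reverse W m′)
  ... | inj₂ (here eq) = here eq

  reverse-path : ∀ {a b} (W : Walk a b) → IsPath W → IsPath (reverse W)
  reverse-path [ a ]         u = u
  reverse-path (a ∷⟨ _ ⟩ W) u@(_ ∷ uW) =
    subst Unique (≡.sym (verts-++ʷ (reverse W) _))
      (Unique.++⁺ (reverse-path W uW) ([] ∷ [])
        λ { (m , here refl) → unique-head u (verts-reverse W m) })

  split : ∀ {a b v} (W : Walk a b) → v ∈ verts W →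
    Σ (Walk a v) λ X → Σ (Walk v b) λ Y → W ≡ X ++ʷ Y
  split [ a ]         (here refl) = [ a ] , [ a ] , refl
  split (a ∷⟨ e ⟩ W) (here refl) = [ a ] , a ∷⟨ e ⟩ W , refl
  split (a ∷⟨ e ⟩ W) (there m) with split W m
  ... | X , Y , refl = a ∷⟨ e ⟩ X , Y , refl

  suffixFrom : ∀ {a b v} (W : Walk a b) → v ∈ verts W →
    Σ (Walk v b) λ W′ → Σ (List V) λ pre → verts W ≡ pre ++ verts W′
  suffixFrom [ a ]         (here refl) = [ a ] , [] , refl
  suffixFrom (a ∷⟨ e ⟩ W) (here refl) = a ∷⟨ e ⟩ W , [] , refl
  suffixFrom (a ∷⟨ e ⟩ W) (there m) with suffixFrom W m
  ... | W′ , pre , eq = W′ , a ∷ pre , cong (a ∷_) eq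

  toPath : ∀ {a b} (W : Walk a b) → Σ (Walk a b) λ W′ → IsPath W′ × verts W′ ⊆ verts W
  toPath [ a ] = [ a ] , [] ∷ [] , λ m → m
  toPath (a ∷⟨ e ⟩ W) with toPath W
  ... | W′ , u , W′⊆W with a ∈? verts W′
  ...   | no a∉W′ = a ∷⟨ e ⟩ W′ , unique-∷ a∉W′ u , λ { (here refl) → here refl ; (there m) → there (W′⊆W m) }
  ...   | yes a∈W′ with suffixFrom W′ a∈W′
  ...     | W″ , pre , W′≡pre++W″ =
    W″ , unique-++⁻ʳ pre (subst Unique W′≡pre++W″ u) ,
    there ∘ W′⊆W ∘ subst (_ ∈_) (≡.sym W′≡pre++W″) ∘ ∈-++⁺ʳ pre

  module _ {P : V → Set} (P? : Decidable P) where

    lastSuffix : ∀ {a b} (W : Walk a b) → Any P (verts W) →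
      Σ V λ c → P c × Σ (Walk c b) λ W′ →
        verts W′ ⊆ verts W × tverts W′ ⊆ tverts W × (∀ {v} → v ∈ tverts W′ → ¬ P v)
    lastSuffix [ a ] (here pa) = a , pa , [ a ] , (λ m → m) , (λ ()) , (λ ())
    lastSuffix (a ∷⟨ e ⟩ W) anyP with Any.any? P? (verts W)
    ... | yes anyPW =
      let c , pc , W′ , sub , tsub , none = lastSuffix W anyPW
      in c , pc , W′ , there ∘ sub , tverts⊆verts W ∘ tsub , none
    ... | no noneW with anyP
    ...   | here pa  = a , pa , a ∷⟨ e ⟩ W , (λ m → m) , (λ m → m) , λ m pv → noneW (Any.map (λ { refl → pv }) m)
    ...   | there pW = ⊥-elim (noneW pW)

    firstPrefix : ∀ {a b} (W : Walk a b) → P b →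
      Σ V λ c → P c × Σ (Walk a c) λ W′ →
        verts W′ ⊆ verts W × (∀ {v} → v ∈ verts W′ → P v → v ≡ c)
    firstPrefix [ a ] pa = a , pa , [ a ] , (λ m → m) , λ { (here eq) _ → eq }
    firstPrefix (a ∷⟨ e ⟩ W) pb with P? a
    ... | yes pa = a , pa , [ a ] , (λ { (here refl) → here refl }) , λ { (here eq) _ → eq }
    ... | no ¬pa =
      let c , pc , W′ , sub , first = firstPrefix W pb
      in c , pc , a ∷⟨ e ⟩ W′ , (λ { (here refl) → here refl ; (there m) → there (sub m) }) ,
         λ { (here refl) pv → ⊥-elim (¬pa pv) ; (there m) pv → first m pv }

  fromLastVisit : ∀ {a b v} (W : Walk a b) → v ∈ verts W →
    Σ (Walk v b) λ W′ → verts W′ ⊆ verts W × tverts W′ ⊆ tverts W × v ∉ tverts W′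
  fromLastVisit {v = v} W v∈W with lastSuffix (_≟ᶠ v) W (Any.map (λ { refl → refl }) v∈W)
  ... | .v , refl , W′ , sub , tsub , none = W′ , sub , tsub , λ m → none m refl

  record Connector (B S : V → Set) : Set where
    field
      start end    : V
      path         : Walk start end
      isPath       : IsPath path
      start∈B      : B start
      end∈S        : S end
      B-only-start : ∀ {v} → v ∈ verts path → B v → v ≡ start
      S-only-end   : ∀ {v} → v ∈ verts path → S v → v ≡ end

  trivialConnector : ∀ {B S : V → Set} {x} → B x → S x → Connector B S
  trivialConnector {x = x} Bx Sx = record
    { start = x ; end = x ; path = [ x ] ; isPath = [] ∷ [] ; start∈B = Bx ; end∈S = Sx
    ; B-only-start = λ { (here eq) _ → eq } ; S-only-end = λ { (here eq) _ → eq } }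

  connector : ∀ {B S : V → Set} → Decidable B → Decidable S → ∀ {t u} (X : Walk t u) → B t → S u →
    Σ (Connector B S) λ C → verts (Connector.path C) ⊆ verts X
  connector {B} {S} B? S? X Bt Su
    with lastSuffix B? X (Any.map (λ { refl → Bt }) (start∈ X))
  ... | c , Bc , X′ , sub₁ , _ , noB with firstPrefix S? X′ Su
  ...   | a , Sa , X″ , sub₂ , firstS with toPath X″
  ...     | P , P-path , sub₃ = record
    { start = c ; end = a ; path = P ; isPath = P-path ; start∈B = Bc ; end∈S = Sa
    ; B-only-start = λ m Bv → only-c (subst (_ ∈_) (verts≡ X′) (sub₂ (sub₃ m))) Bv
    ; S-only-end = λ m Sv → firstS (sub₃ m) Sv }
    , sub₁ ∘ sub₂ ∘ sub₃
    where
    only-c : ∀ {v} → v ∈ c ∷ tverts X′ → B v → v ≡ c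
    only-c (here eq) _  = eq
    only-c (there m) Bv = ⊥-elim (noB m Bv)

module CycleWalks (G : Graph) where
  open Walks G

  record CycleWalk (L : ℕ) : Set where
    field
      base    : V
      walk    : Walk base base
      simple  : Unique (tverts walk)
      length≡ : len walk ≡ L

  On : ∀ {L} → CycleWalk L → V → Set
  On Ω v = v ∈ tverts (CycleWalk.walk Ω)

  vertexAt : ∀ {a b} (W : Walk a b) → Fin (suc (len W)) → V
  vertexAt [ a ]         zero    = a
  vertexAt (a ∷⟨ _ ⟩ W) zero    = a
  vertexAt (a ∷⟨ _ ⟩ W) (suc i) = vertexAt W i

  vertexAt-start : ∀ {a b} (W : Walk a b) → vertexAt W zero ≡ a
  vertexAt-start [ a ]         = refl
  vertexAt-start (a ∷⟨ _ ⟩ W) = refl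

  vertexAt-end : ∀ {a b} (W : Walk a b) → vertexAt W (fromℕ (len W)) ≡ b
  vertexAt-end [ a ]         = refl
  vertexAt-end (a ∷⟨ _ ⟩ W) = vertexAt-end W

  vertexAt-step : ∀ {a b} (W : Walk a b) (i : Fin (len W)) →
    Adj G (vertexAt W (inject₁ i)) (vertexAt W (suc i))
  vertexAt-step (a ∷⟨ e ⟩ W) zero    = subst (Adj G a) (≡.sym (vertexAt-start W)) e
  vertexAt-step (a ∷⟨ _ ⟩ W) (suc i) = vertexAt-step W i

  vertexAt∈ : ∀ {a b} (W : Walk a b) i → vertexAt W i ∈ verts W
  vertexAt∈ [ a ]         zero    = here refl
  vertexAt∈ (a ∷⟨ _ ⟩ W) zero    = here refl
  vertexAt∈ (a ∷⟨ _ ⟩ W) (suc i) = there (vertexAt∈ W i)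

  vertexAt-injective : ∀ {a b} (W : Walk a b) → IsPath W → ∀ i j → vertexAt W i ≡ vertexAt W j → i ≡ j
  vertexAt-injective [ a ]         _ zero    zero    _  = refl
  vertexAt-injective (a ∷⟨ _ ⟩ W) _ zero    zero    _  = refl
  vertexAt-injective (a ∷⟨ _ ⟩ W) u zero    (suc j) eq =
    ⊥-elim (unique-head u (subst (_∈ verts W) (≡.sym eq) (vertexAt∈ W j)))
  vertexAt-injective (a ∷⟨ _ ⟩ W) u (suc i) zero    eq =
    ⊥-elim (unique-head u (subst (_∈ verts W) eq (vertexAt∈ W i)))
  vertexAt-injective (a ∷⟨ _ ⟩ W) (_ ∷ u) (suc i) (suc j) eq = cong suc (vertexAt-injective W u i j eq)

  cycleOf : ∀ {c} (Z : Walk c c) → Unique (tverts Z) → 3 ≤ len Z → Cycle G (len Z)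
  cycleOf (c ∷⟨ e ⟩ W) u 3≤len = record
    { p = len W ; len≡ = refl ; len≥3 = 3≤len ; vtx = vertexAt W
    ; inj = λ {i} {j} → vertexAt-injective W u i j
    ; step = vertexAt-step W
    ; close = subst₂ (Adj G) (≡.sym (vertexAt-end W)) (≡.sym (vertexAt-start W)) e }

  walkThrough : ∀ m (f : Fin (suc m) → V) → (∀ (i : Fin m) → Adj G (f (inject₁ i)) (f (suc i))) →
    Σ (Walk (f zero) (f (fromℕ m))) λ W → verts W ≡ tabulate f × len W ≡ m
  walkThrough zero    f adj = [ f zero ] , refl , refl
  walkThrough (suc m) f adj with walkThrough m (f ∘ suc) (adj ∘ suc)
  ... | W , verts≡tab , len≡m = f zero ∷⟨ adj zero ⟩ W , cong (f zero ∷_) verts≡tab , cong suc len≡m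

  fromCycle : ∀ {L} (C : Cycle G L) →
    Σ (CycleWalk L) λ Ω → (∀ {v} → OnCycle C v → On Ω v) × (∀ {v} → On Ω v → OnCycle C v)
  fromCycle C with walkThrough (p C) (vtx C) (step C)
  ... | W , verts≡tab , len≡p =
    record { walk = _ ∷⟨ close C ⟩ W
           ; simple = subst Unique (≡.sym verts≡tab) (Unique.tabulate⁺ (inj C))
           ; length≡ = trans (cong suc len≡p) (≡.sym (len≡ C)) } ,
    (λ { (i , refl) → subst (_ ∈_) (≡.sym verts≡tab) (∈-tabulate⁺ {f = vtx C} i) }) ,
    λ m → let i , v≡ = ∈-tabulate⁻ {f = vtx C} (subst (_ ∈_) verts≡tab m) in i , ≡.sym v≡

  twoVertices : ∀ {L} (C : Cycle G L) → Σ V λ u → Σ V λ v → u ≢ v × OnCycle C u × OnCycle C v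
  twoVertices C = vtx C zero , vtx C one , (λ eq → zero≢one (inj C eq)) , (zero , refl) , (one , refl)
    where
    1≤p : 1 ≤ p C
    1≤p with subst (3 ≤_) (len≡ C) (len≥3 C)
    ... | s≤s (s≤s 1≤p) = ≤-trans (s≤s z≤n) (s≤s 1≤p)
    one : Fin (suc (p C))
    one = fromℕ< (s≤s 1≤p)
    zero≢one : zero ≢ one
    zero≢one eq with trans (cong toℕ eq) (toℕ-fromℕ< (s≤s 1≤p))
    ... | ()

  onCycle? : ∀ {L} (C : Cycle G L) → Decidable (OnCycle C)
  onCycle? C v = any? λ i → vtx C i ≟ᶠ v

  record Arcs (L : ℕ) (a b : V) : Set where
    field
      α       : Walk a b
      β       : Walk b a
      simple  : Unique (tverts α ++ tverts β)
      length≡ : len α + len β ≡ L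

  arcs : ∀ {L} (Ω : CycleWalk L) {a b} → On Ω a → On Ω b →
    Σ (Arcs L a b) λ A → tverts (Arcs.α A) ++ tverts (Arcs.β A) ⊆ tverts (CycleWalk.walk Ω)
  arcs {L} record { walk = W ; simple = u ; length≡ = len≡L } {a} {b} a∈ b∈ with split W (tverts⊆verts W a∈)
  ... | X , Y , refl =
    record { α = α ; β = β ; simple = subst Unique (≡.sym tverts-αβ) simple-YX ; length≡ = length≡ } ,
    from-YX ∘ subst (_ ∈_) tverts-αβ
    where
    -- The rotated closed walk Y X lists the same vertices as X Y.
    from-YX : tverts Y ++ tverts X ⊆ tverts (X ++ʷ Y)
    from-YX = subst (_ ∈_) (≡.sym (tverts-++ʷ X Y)) ∘ ∈-++-comm (tverts Y)
    to-YX : tverts (X ++ʷ Y) ⊆ tverts (Y ++ʷ X)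
    to-YX = subst (_ ∈_) (≡.sym (tverts-++ʷ Y X)) ∘ ∈-++-comm (tverts X) ∘ subst (_ ∈_) (tverts-++ʷ X Y)
    simple-YX : Unique (tverts Y ++ tverts X)
    simple-YX = unique-++-comm (tverts X) (subst Unique (tverts-++ʷ X Y) u)
    cut : Σ (Walk a b) λ α → Σ (Walk b a) λ β → Y ++ʷ X ≡ α ++ʷ β
    cut = split (Y ++ʷ X) (tverts⊆verts (Y ++ʷ X) (to-YX b∈))
    α : Walk a b
    α = proj₁ cut
    β : Walk b a
    β = proj₁ (proj₂ cut)
    YX≡αβ : Y ++ʷ X ≡ α ++ʷ β
    YX≡αβ = proj₂ (proj₂ cut)
    tverts-αβ : tverts α ++ tverts β ≡ tverts Y ++ tverts X
    tverts-αβ = trans (≡.sym (tverts-++ʷ α β)) (trans (cong tverts (≡.sym YX≡αβ)) (tverts-++ʷ Y X))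
    length≡ : len α + len β ≡ L
    length≡ = begin
      len α + len β   ≡⟨ ≡.sym (len-++ʷ α β) ⟩
      len (α ++ʷ β)   ≡⟨ cong len (≡.sym YX≡αβ) ⟩
      len (Y ++ʷ X)   ≡⟨ len-++ʷ Y X ⟩
      len Y + len X   ≡⟨ +-comm (len Y) (len X) ⟩
      len X + len Y   ≡⟨ ≡.sym (len-++ʷ X Y) ⟩
      len (X ++ʷ Y)   ≡⟨ len≡L ⟩
      L               ∎
      where open ≡.≡-Reasoning

  arc-path : ∀ {a b} → a ≢ b → (α : Walk a b) (β : Walk b a) → Unique (tverts α ++ tverts β) →
    PathIn (_∈ tverts α ++ tverts β) α
  arc-path a≢a [ a ] β u = ⊥-elim (a≢a refl)
  arc-path a≢b (a ∷⟨ _ ⟩ W) β u =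
    unique-∷ (λ a∈W → unique-++⁻-disjoint (verts W) u (a∈W , a∈β)) (unique-++⁻ˡ (verts W) u) ,
    λ { (here refl) → ∈-++⁺ʳ (verts W) a∈β ; (there m) → ∈-++⁺ˡ m }
    where
    a∈β : _ ∈ tverts β
    a∈β = end∈tverts β (a≢b ∘ ≡.sym)

  module _ {L} (Ω : CycleWalk L) {a b} (a≢b : a ≢ b) (A : Arcs L a b)
           (A⊆Ω : tverts (Arcs.α A) ++ tverts (Arcs.β A) ⊆ tverts (CycleWalk.walk Ω)) where
    open Arcs A

    arc-forward : PathIn (On Ω) α
    arc-forward = let α-path , α⊆ = arc-path a≢b α β simple in α-path , A⊆Ω ∘ α⊆

    arc-backward : PathIn (On Ω) (reverse β)
    arc-backward =
      let β-path , β⊆ = arc-path (a≢b ∘ ≡.sym) β α (unique-++-comm (tverts α) simple)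
      in reverse-path β β-path , A⊆Ω ∘ ∈-++-comm (tverts β) ∘ β⊆ ∘ verts-reverse β

-- Deleting any vertex x leaves the graph connected.  Stated with a double
-- negation, which suffices because the final statement is decidable.
NoCutVertex : Graph → Set
NoCutVertex G = ∀ x y z → y ≢ x → z ≢ x → ¬ ¬ (Σ (Walk y z) λ W → Avoids W x)
  where open Walks G

induced : (G : Graph) → (Fin (n G) → Set) → Subgraph G
induced G U = record
  { V' = U ; E' = λ u v → Adj G u v × U u × U v
  ; E'sym = λ (e , Uu , Uv) → sym G e , Uv , Uu ; E'⊆E = proj₁ ; E'ends = proj₂ }

threeColouring : ∀ {G} {H : Subgraph G} → ChromaticLess H 4 → Colorable H 3
threeColouring (c , s≤s c≤3 , col , proper) =
  (λ v → inject≤ (col v) c≤3) , λ e eq → proper e (inject≤-injective c≤3 c≤3 _ _ eq)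

-- Swapping colours i and j sends i to j without merging colours; this aligns
-- two colourings at one vertex.
transpose-hit : ∀ {m} (i j : Fin m) → transpose i j i ≡ j
transpose-hit i j rewrite dec-true (i ≟ᶠ i) refl = refl

transpose-injective : ∀ {m} (i j : Fin m) {x y} → transpose i j x ≡ transpose i j y → x ≡ y
transpose-injective i j {x} {y} eq =
  trans (≡.sym (transpose-inverse j i)) (trans (cong (transpose j i) eq) (transpose-inverse j i))

module Criticality (G : Graph) where
  open Walks G

  -- Let R be a set of vertices not containing x whose only neighbour outside R
  -- is x.  Then 3-colourings of R ∪ {x} and of the complement of R, after
  -- permuting colours to agree at x, combine to a 3-colouring of G.
  glue : (R : V → Set) (x : V) → (∀ v → Dec (R v)) → ¬ R x →
    (∀ {u v} → Adj G u v → R u → ¬ R v → v ≡ x) →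
    Colorable (induced G λ v → R v ⊎ v ≡ x) 3 → Colorable (induced G (¬_ ∘ R)) 3 →
    Colorable (full G) 3
  glue R x R? ¬Rx leaves-via-x (g₁ , proper₁) (g₂ , proper₂) = colour , proper
    where
    π : Fin 3 → Fin 3
    π = transpose (g₂ x) (g₁ x)
    agree : ∀ {v} → v ≡ x → π (g₂ v) ≡ g₁ v
    agree refl = transpose-hit (g₂ x) (g₁ x)
    colour : V → Fin 3
    colour v with R? v
    ... | yes _ = g₁ v
    ... | no _  = π (g₂ v)
    proper : ∀ {u v} → Adj G u v → colour u ≢ colour v
    proper {u} {v} e with R? u | R? v
    ... | yes Ru | yes Rv = proper₁ (e , inj₁ Ru , inj₁ Rv)
    ... | no ¬Ru | no ¬Rv = proper₂ (e , ¬Ru , ¬Rv) ∘ transpose-injective (g₂ x) (g₁ x)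
    ... | yes Ru | no ¬Rv = λ eq →
      proper₁ (e , inj₁ Ru , inj₂ (leaves-via-x e Ru ¬Rv)) (trans eq (agree (leaves-via-x e Ru ¬Rv)))
    ... | no ¬Ru | yes Rv = λ eq →
      proper₁ (sym G e , inj₁ Rv , inj₂ (leaves-via-x (sym G e) Rv ¬Ru))
        (trans (≡.sym eq) (agree (leaves-via-x (sym G e) Rv ¬Ru)))

  -- If y cannot reach z in G − x, let R be the vertices that can.  Both
  -- R ∪ {x} (missing y) and its complement (missing z) are proper subgraphs,
  -- hence 3-colourable, and gluing gives a 3-colouring of G.
  fourCritical⇒noCutVertex : FourCritical G → NoCutVertex G
  fourCritical⇒noCutVertex ((_ , notFewer) , critical) x y z y≢x z≢x y↛z =
    ¬¬-∀-Fin (n G) (λ _ → ¬¬-excluded-middle) λ R? →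
      notFewer 3 (s≤s (s≤s (s≤s (s≤s z≤n))))
        (glue R x R? ¬Rx leaves-via-x colour-R∪x colour-¬R)
    where
    R : V → Set
    R v = Σ (Walk v z) λ W → Avoids W x
    ¬Rx : ¬ R x
    ¬Rx (W , avoids) = avoids (start∈ W) refl
    colour-R∪x : Colorable (induced G λ v → R v ⊎ v ≡ x) 3
    colour-R∪x = threeColouring {H = induced G λ v → R v ⊎ v ≡ x}
      (critical (induced G λ v → R v ⊎ v ≡ x) (inj₁ (y , [ y↛z , y≢x ]′)))
    colour-¬R : Colorable (induced G (¬_ ∘ R)) 3
    colour-¬R = threeColouring {H = induced G (¬_ ∘ R)}
      (critical (induced G (¬_ ∘ R)) (inj₁ (z , λ ¬Rz → ¬Rz ([ z ] , λ { (here refl) → z≢x }))))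
    leaves-via-x : ∀ {u v} → Adj G u v → R u → ¬ R v → v ≡ x
    leaves-via-x {u} {v} e (W , avoids) ¬Rv with v ≟ᶠ x
    ... | yes v≡x = v≡x
    ... | no v≢x  = ⊥-elim (¬Rv (v ∷⟨ sym G e ⟩ W , λ { (here refl) → v≢x ; (there m) → avoids m }))

-- In a graph without cut vertex, two vertices outside a set S with at least
-- two elements are joined to S by disjoint walks (the fan lemma for two paths).
module TwoPaths (G : Graph) (noCut : NoCutVertex G) {S : Fin (n G) → Set} (S? : Decidable S)
                {s₀ s₁ : Fin (n G)} (s₀≢s₁ : s₀ ≢ s₁) (S₀ : S s₀) (S₁ : S s₁) where
  open Walks G

  record Fan (w : V) : Set where
    field
      end₁ end₂ : V
      end₁∈S    : S end₁
      end₂∈S    : S end₂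
      R₁        : Walk w end₁
      R₂        : Walk w end₂
      meet-at-w : ∀ {v} → v ∈ verts R₁ → v ∈ verts R₂ → v ≡ w

  record Linkage (t u : V) : Set where
    field
      end₁ end₂ : V
      end₁∈S    : S end₁
      end₂∈S    : S end₂
      X₁        : Walk t end₁
      X₂        : Walk u end₂
      disjoint  : Disjoint (verts X₁) (verts X₂)

  -- If a walk from y first meets the branch R of a fan at z ≠ w, then
  -- following it to z and then R gives, together with the other branch R′,
  -- a linkage from w and y.
  viaBranch : ∀ {w y z s s′} (R : Walk w s) (R′ : Walk w s′) → S s → S s′ →
    (∀ {v} → v ∈ verts R → v ∈ verts R′ → v ≡ w) → w ∉ tverts R →
    (Wz : Walk y z) → z ≢ w → z ∈ verts R → (∀ {v} → v ∈ verts Wz → v ∈ verts R′ → v ≡ z) →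
    Linkage w y
  viaBranch {w} R R′ Ss Ss′ meet w∉R Wz z≢w z∈R first-on-R′ with fromLastVisit R z∈R
  ... | Rz , _ , Rz⊆R , _ = record
    { end₁ = _ ; end₂ = _ ; end₁∈S = Ss′ ; end₂∈S = Ss ; X₁ = R′ ; X₂ = Wz ++ʷ Rz
    ; disjoint = λ (m′ , m) → separate m′ (∈-++⁻ (verts Wz) (subst (_ ∈_) (verts-++ʷ Wz Rz) m)) }
    where
    separate : ∀ {v} → v ∈ verts R′ → v ∈ verts Wz ⊎ v ∈ tverts Rz → ⊥
    separate m′ (inj₁ on-Wz) = z≢w (meet z∈R (subst (_∈ verts R′) (first-on-R′ on-Wz m′) m′))
    separate m′ (inj₂ on-Rz) =
      w∉R (subst (_∈ tverts R) (meet (tverts⊆verts R (Rz⊆R on-Rz)) m′) (Rz⊆R on-Rz))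

  -- A fan at w and a walk from y into S avoiding w yield a linkage from w
  -- and y: follow the walk until it first meets a branch or S.
  reroute : ∀ {w y s} → Fan w → (W : Walk y s) → S s → Avoids W w → Linkage w y
  reroute {w} {y} F W Ss avoids
    with fromLastVisit (Fan.R₁ F) (start∈ (Fan.R₁ F)) | fromLastVisit (Fan.R₂ F) (start∈ (Fan.R₂ F))
  ... | R₁ , R₁⊆ , _ , w∉R₁ | R₂ , R₂⊆ , _ , w∉R₂ =
    rerouteNormal R₁ R₂ (λ m₁ m₂ → Fan.meet-at-w F (R₁⊆ m₁) (R₂⊆ m₂)) w∉R₁ w∉R₂
    where
    -- the fan with its branches shortened so that w occurs only at their start
    rerouteNormal : (R₁ : Walk w (Fan.end₁ F)) (R₂ : Walk w (Fan.end₂ F)) →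
      (∀ {v} → v ∈ verts R₁ → v ∈ verts R₂ → v ≡ w) → w ∉ tverts R₁ → w ∉ tverts R₂ → Linkage w y
    rerouteNormal R₁ R₂ meet w∉R₁ w∉R₂ with firstPrefix Hit? W (inj₂ (inj₂ Ss))
      where
      Hit : V → Set
      Hit v = v ∈ verts R₁ ⊎ v ∈ verts R₂ ⊎ S v
      Hit? : Decidable Hit
      Hit? v = v ∈? verts R₁ ⊎? (v ∈? verts R₂ ⊎? S? v)
    ... | z , hit , Wz , Wz⊆W , first
      with z ∈? verts R₁ | z ∈? verts R₂
    ... | yes z∈R₁ | _ =
      viaBranch R₁ R₂ (Fan.end₁∈S F) (Fan.end₂∈S F) meet w∉R₁ Wz (avoids (Wz⊆W (end∈ Wz))) z∈R₁
        λ m m′ → first m (inj₂ (inj₁ m′))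
    ... | no _ | yes z∈R₂ =
      viaBranch R₂ R₁ (Fan.end₂∈S F) (Fan.end₁∈S F) (λ m₂ m₁ → meet m₁ m₂) w∉R₂ Wz
        (avoids (Wz⊆W (end∈ Wz))) z∈R₂ λ m m′ → first m (inj₁ m′)
    ... | no z∉R₁ | no z∉R₂ = record
      { end₁ = _ ; end₂ = _ ; end₁∈S = Fan.end₁∈S F
      ; end₂∈S = [ ⊥-elim ∘ z∉R₁ , [ ⊥-elim ∘ z∉R₂ , (λ Sz → Sz) ]′ ]′ hit
      ; X₁ = R₁ ; X₂ = Wz
      ; disjoint = λ (m₁ , m) → z∉R₁ (subst (_∈ verts R₁) (first m (inj₁ m₁)) m₁) }

  fanOfLinkage : ∀ {w w′} → Adj G w w′ → Linkage w′ w → Fan w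
  fanOfLinkage {w} e K = record
    { end₁ = _ ; end₂ = _ ; end₁∈S = Linkage.end₂∈S K ; end₂∈S = Linkage.end₁∈S K
    ; R₁ = Linkage.X₂ K ; R₂ = w ∷⟨ e ⟩ Linkage.X₁ K
    ; meet-at-w = λ { m (here eq) → eq ; m (there m′) → ⊥-elim (Linkage.disjoint K (m′ , m)) } }

  -- Every vertex w ∉ S with a walk into S has a fan, by induction on the
  -- walk: either the next vertex w′ lies in S, or a fan at w′ is rerouted
  -- along a walk from w into S that avoids w′.
  fan : ∀ {w s} (W : Walk w s) → S s → ¬ S w → ¬ ¬ Fan w
  fan [ s ] Ss ¬Ss = ⊥-elim (¬Ss Ss)
  fan (_∷⟨_⟩_ w {w′} e W) Ss ¬Sw with S? w′
  ... | yes Sw′ =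
    let s₂ , Ss₂ , s₂≢w′ = another s₀≢s₁ S₀ S₁ w′ in
    noCut w′ w s₂ w≢w′ s₂≢w′ >>= λ (W₂ , avoids) →
    let z , Sz , R₂ , R₂⊆W₂ , _ = firstPrefix S? W₂ Ss₂ in
    pure record
      { end₁ = w′ ; end₂ = z ; end₁∈S = Sw′ ; end₂∈S = Sz ; R₁ = w ∷⟨ e ⟩ [ w′ ] ; R₂ = R₂
      ; meet-at-w = λ { (here eq) _ → eq ; (there (here refl)) m → ⊥-elim (avoids (R₂⊆W₂ m) refl) } }
    where
    w≢w′ : w ≢ w′
    w≢w′ refl = ¬Sw Sw′
  ... | no ¬Sw′ =
    fan W Ss ¬Sw′ >>= λ F →
    noCut w′ w (Fan.end₁ F) w≢w′ (¬Sw′ ∘ λ { refl → Fan.end₁∈S F }) >>= λ (W₁ , avoids) →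
    pure (fanOfLinkage e (reroute F W₁ (Fan.end₁∈S F) avoids))
    where
    w≢w′ : w ≢ w′
    w≢w′ refl = irr G e

  -- Two distinct vertices t, u outside S are linked to S by disjoint walks:
  -- t has a walk into S (G − u is connected), hence a fan, which is rerouted
  -- along a walk from u into S avoiding t.
  linkage : ∀ {t u} → t ≢ u → ¬ S t → ¬ S u → ¬ ¬ Linkage t u
  linkage {t} {u} t≢u ¬St ¬Su =
    noCut u t s₀ t≢u (¬Su ∘ λ { refl → S₀ }) >>= λ (W , _) →
    fan W S₀ ¬St >>= λ F →
    noCut t u (Fan.end₁ F) (t≢u ∘ ≡.sym) (¬St ∘ λ { refl → Fan.end₁∈S F }) >>= λ (W′ , avoids) →
    pure (reroute F W′ (Fan.end₁∈S F) avoids)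

module LongestOddCycles (G : Graph) (L : ℕ) (oddL : Odd L)
                        (longest : ∀ m → Cycle G m → Odd m → m ≤ L) where
  open Walks G
  open CycleWalks G
  open Connector

  module DoubleLink {A B : V → Set} (P Q : Connector B A)
                    (P#Q : Disjoint (verts (path P)) (verts (path Q)))
                    (shared : ∀ {v} → A v → B v → v ≡ end P) where

    a≢b : end P ≢ end Q
    a≢b a≡b = P#Q (end∈ (path P) , subst (_∈ verts (path Q)) (≡.sym a≡b) (end∈ (path Q)))

    c≢d : start P ≢ start Q
    c≢d c≡d = P#Q (start∈ (path P) , subst (_∈ verts (path Q)) (≡.sym c≡d) (start∈ (path Q)))

    d≢b : start Q ≢ end Q
    d≢b d≡b = a≢b (≡.sym (shared (end∈S Q) (subst B d≡b (start∈B Q))))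

    s : ℕ
    s = len (path P) + len (path Q)

    -- For paths σ : a → b inside A and τ : d → c inside B, the closed walk
    -- P σ Q⁻¹ τ is a cycle; hence its length is at most L if it is odd.
    crossing-bound : ∀ (σ : Walk (end P) (end Q)) (τ : Walk (start Q) (start P)) →
      PathIn A σ → PathIn B τ → OddAtMost L (s + (len σ + len τ))
    crossing-bound σ τ (σ-path , σ⊆A) (τ-path , τ⊆B) odd =
      subst (_≤ L) len-Z (longest _ (cycleOf Z simple 3≤len) (subst Odd (≡.sym len-Z) odd))
      where
      Q⁻ : Walk (end Q) (start Q)
      Q⁻ = reverse (path Q)
      Z : Walk (start P) (start P)
      Z = path P ++ʷ σ ++ʷ Q⁻ ++ʷ τ

      len-Z : len Z ≡ s + (len σ + len τ)
      len-Z = trans (len-++ʷ (path P) _) (trans (cong (len (path P) +_) (trans (len-++ʷ σ _)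
                (cong (len σ +_) (trans (len-++ʷ Q⁻ τ) (cong (_+ len τ) (len-reverse (path Q)))))))
                (regroup (len (path P)) (len σ) (len (path Q)) (len τ)))
        where
        regroup : ∀ p x q y → p + (x + (q + y)) ≡ p + q + (x + y)
        regroup = solve-∀

      3≤len : 3 ≤ len Z
      3≤len = subst (3 ≤_) (≡.sym len-Z)
        (≤-trans (+-mono-≤ (len-positive d≢b (path Q))
                   (+-mono-≤ (len-positive a≢b σ) (len-positive (c≢d ∘ ≡.sym) τ)))
                 (+-monoˡ-≤ _ (m≤n+m (len (path Q)) (len (path P)))))

      on-Q : ∀ {v} → v ∈ tverts Q⁻ → v ∈ verts (path Q)
      on-Q = verts-reverse (path Q) ∘ tverts⊆verts Q⁻

      Q⁻#τ : Disjoint (tverts Q⁻) (tverts τ)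
      Q⁻#τ (m , m′) = path-start∉tverts τ τ-path
        (subst (_∈ tverts τ) (B-only-start Q (on-Q m) (τ⊆B (tverts⊆verts τ m′))) m′)

      σ#Q⁻τ : Disjoint (tverts σ) (tverts Q⁻ ++ tverts τ)
      σ#Q⁻τ (m , m′) with ∈-++⁻ (tverts Q⁻) m′
      ... | inj₁ on-Q⁻ = path-start∉tverts Q⁻ (reverse-path (path Q) (isPath Q))
        (subst (_∈ tverts Q⁻) (S-only-end Q (on-Q on-Q⁻) (σ⊆A (tverts⊆verts σ m))) on-Q⁻)
      ... | inj₂ on-τ = path-start∉tverts σ σ-path
        (subst (_∈ tverts σ) (shared (σ⊆A (tverts⊆verts σ m)) (τ⊆B (tverts⊆verts τ on-τ))) m)

      P#σQ⁻τ : Disjoint (tverts (path P)) (tverts σ ++ tverts Q⁻ ++ tverts τ)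
      P#σQ⁻τ (m , m′) with ∈-++⁻ (tverts σ) m′
      ... | inj₁ on-σ = path-start∉tverts σ σ-path
        (subst (_∈ tverts σ) (S-only-end P (tverts⊆verts (path P) m) (σ⊆A (tverts⊆verts σ on-σ))) on-σ)
      ... | inj₂ m″ with ∈-++⁻ (tverts Q⁻) m″
      ...   | inj₁ on-Q⁻ = P#Q (tverts⊆verts (path P) m , on-Q on-Q⁻)
      ...   | inj₂ on-τ = path-start∉tverts (path P) (isPath P)
        (subst (_∈ tverts (path P)) (B-only-start P (tverts⊆verts (path P) m) (τ⊆B (tverts⊆verts τ on-τ))) m)

      tverts-Z : tverts Z ≡ tverts (path P) ++ tverts σ ++ tverts Q⁻ ++ tverts τ
      tverts-Z = trans (tverts-++ʷ (path P) _)
        (cong (tverts (path P) ++_) (trans (tverts-++ʷ σ _) (cong (tverts σ ++_) (tverts-++ʷ Q⁻ τ))))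

      simple : Unique (tverts Z)
      simple = subst Unique (≡.sym tverts-Z)
        (Unique.++⁺ (path-tverts (path P) (isPath P))
          (Unique.++⁺ (path-tverts σ σ-path)
            (Unique.++⁺ (path-tverts Q⁻ (reverse-path (path Q) (isPath Q))) (path-tverts τ τ-path) Q⁻#τ)
            σ#Q⁻τ)
          P#σQ⁻τ)

    crossing-bound′ : ∀ {σ : Walk (end P) (end Q)} {τ : Walk (start Q) (start P)} → PathIn A σ → PathIn B τ →
      ∀ {x y} → len σ ≡ x → len τ ≡ y → OddAtMost L (s + (x + y))
    crossing-bound′ {σ} {τ} σ-in-A τ-in-B refl refl = crossing-bound σ τ σ-in-A τ-in-B

  -- Cut Ω₁ at
  -- the ends a, b of the connectors into arcs α, β and Ω₂ at their starts
  -- d, c into arcs δ, γ; the four crossing cycles contradict crossing-parity.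
  noDoubleLink : (Ω₁ Ω₂ : CycleWalk L) (P Q : Connector (On Ω₂) (On Ω₁)) →
    Disjoint (verts (path P)) (verts (path Q)) → (∀ {v} → On Ω₁ v → On Ω₂ v → v ≡ end P) → ⊥
  noDoubleLink Ω₁ Ω₂ P Q P#Q shared
    with arcs Ω₁ {end P} {end Q} (end∈S P) (end∈S Q) | arcs Ω₂ {start Q} {start P} (start∈B Q) (start∈B P)
  ... | arcs₁ , arcs₁⊆Ω₁ | arcs₂ , arcs₂⊆Ω₂ =
    crossing-parity s (len α) (len β) (len γ) (len δ) L oddL
      (≤-trans (len-positive d≢b (path Q)) (m≤n+m _ _))
      (Arcs.length≡ arcs₁) (trans (+-comm (len γ) (len δ)) (Arcs.length≡ arcs₂))
      (crossing-bound′ α-in-Ω₁ δ-in-Ω₂ refl refl)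
      (crossing-bound′ β⁻-in-Ω₁ γ⁻-in-Ω₂ (len-reverse β) (len-reverse γ))
      (crossing-bound′ α-in-Ω₁ γ⁻-in-Ω₂ refl (len-reverse γ))
      (crossing-bound′ β⁻-in-Ω₁ δ-in-Ω₂ (len-reverse β) refl)
    where
    open DoubleLink P Q P#Q shared
    open Arcs arcs₁ using (α; β)
    open Arcs arcs₂ renaming (α to δ; β to γ)
    α-in-Ω₁ : PathIn (On Ω₁) α
    α-in-Ω₁ = arc-forward Ω₁ a≢b arcs₁ arcs₁⊆Ω₁
    β⁻-in-Ω₁ : PathIn (On Ω₁) (reverse β)
    β⁻-in-Ω₁ = arc-backward Ω₁ a≢b arcs₁ arcs₁⊆Ω₁
    δ-in-Ω₂ : PathIn (On Ω₂) δ
    δ-in-Ω₂ = arc-forward Ω₂ (c≢d ∘ ≡.sym) arcs₂ arcs₂⊆Ω₂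
    γ⁻-in-Ω₂ : PathIn (On Ω₂) (reverse γ)
    γ⁻-in-Ω₂ = arc-backward Ω₂ (c≢d ∘ ≡.sym) arcs₂ arcs₂⊆Ω₂

  on? : (Ω : CycleWalk L) → Decidable (On Ω)
  on? Ω v = v ∈? tverts (CycleWalk.walk Ω)

  TwoVerticesOn : CycleWalk L → Set
  TwoVerticesOn Ω = Σ V λ u → Σ V λ v → u ≢ v × On Ω u × On Ω v

  -- If they share x, the connectors are x itself and a
  -- connector inside a walk between the cycles avoiding x; otherwise they are
  -- found inside two disjoint walks from Ω₂ to Ω₁.
  atMostOneCommon⇒⊥ : NoCutVertex G → (Ω₁ Ω₂ : CycleWalk L) → TwoVerticesOn Ω₁ → TwoVerticesOn Ω₂ →
    (∀ {u v} → On Ω₁ u → On Ω₂ u → On Ω₁ v → On Ω₂ v → u ≡ v) → ⊥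
  atMostOneCommon⇒⊥ noCut Ω₁ Ω₂ (a₀ , a₁ , a₀≢a₁ , A₀ , A₁) (b₀ , b₁ , b₀≢b₁ , B₀ , B₁) oneCommon
    with any? (λ v → on? Ω₁ v ×? on? Ω₂ v)
  ... | yes (x , Ax , Bx) =
    let a , Aa , a≢x = another a₀≢a₁ A₀ A₁ x
        b , Bb , b≢x = another b₀≢b₁ B₀ B₁ x
    in noCut x b a b≢x a≢x λ (W , avoids) →
       let Q , Q⊆W = connector (on? Ω₂) (on? Ω₁) W Bb Aa
       in noDoubleLink Ω₁ Ω₂ (trivialConnector Bx Ax) Q
            (λ { (here refl , m) → avoids (Q⊆W m) refl })
            (λ Av Bv → oneCommon Av Bv Ax Bx)
  ... | no noCommon =
    linkage b₀≢b₁ (λ A → noCommon (b₀ , A , B₀)) (λ A → noCommon (b₁ , A , B₁)) λ K →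
    let P , P⊆X₁ = connector (on? Ω₂) (on? Ω₁) (Linkage.X₁ K) B₀ (Linkage.end₁∈S K)
        Q , Q⊆X₂ = connector (on? Ω₂) (on? Ω₁) (Linkage.X₂ K) B₁ (Linkage.end₂∈S K)
    in noDoubleLink Ω₁ Ω₂ P Q
         (λ (m , m′) → Linkage.disjoint K (P⊆X₁ m , Q⊆X₂ m′))
         (λ Av Bv → ⊥-elim (noCommon (_ , Av , Bv)))
    where
    open TwoPaths G noCut (on? Ω₁) a₀≢a₁ A₀ A₁

  longestOddCyclesMeetTwice : NoCutVertex G → (C₁ C₂ : Cycle G L) →
    ∃ λ u → ∃ λ v → u ≢ v × OnCycle C₁ u × OnCycle C₂ u × OnCycle C₁ v × OnCycle C₂ v
  longestOddCyclesMeetTwice noCut C₁ C₂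
    with any? (λ u → any? λ v → ¬? (u ≟ᶠ v) ×? onCycle? C₁ u ×? onCycle? C₂ u ×? onCycle? C₁ v ×? onCycle? C₂ v)
  ... | yes meet = meet
  ... | no ¬meet with fromCycle C₁ | fromCycle C₂
  ...   | Ω₁ , to₁ , from₁ | Ω₂ , to₂ , from₂ =
    ⊥-elim (atMostOneCommon⇒⊥ noCut Ω₁ Ω₂ (twoOn C₁ Ω₁ to₁) (twoOn C₂ Ω₂ to₂) oneCommon)
    where
    twoOn : (C : Cycle G L) (Ω : CycleWalk L) → (∀ {v} → OnCycle C v → On Ω v) → TwoVerticesOn Ω
    twoOn C _ to = let u , v , u≢v , Cu , Cv = twoVertices C in u , v , u≢v , to Cu , to Cv
    oneCommon : ∀ {u v} → On Ω₁ u → On Ω₂ u → On Ω₁ v → On Ω₂ v → u ≡ v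
    oneCommon {u} {v} Au Bu Av Bv with u ≟ᶠ v
    ... | yes u≡v = u≡v
    ... | no u≢v  = ⊥-elim (¬meet (u , v , u≢v , from₁ Au , from₂ Bu , from₁ Av , from₂ Bv))

lemma8 : (k l : ℕ) → 5 ≤ k → 1 ≤ l → (G : Graph) → FourCritical G →
    ((m : ℕ) → (InL G m → (m ≡ k ⊎ m ≡ k + 2 * l)) × ((m ≡ k ⊎ m ≡ k + 2 * l) → InL G m)) →
    (C₁ C₂ : Cycle G (k + 2 * l)) →
    ∃ λ u → ∃ λ v → u ≢ v × OnCycle C₁ u × OnCycle C₂ u × OnCycle C₁ v × OnCycle C₂ v
lemma8 k l _ _ G critical L[G] =
  LongestOddCycles.longestOddCyclesMeetTwice G (k + 2 * l) oddL longest
    (Criticality.fourCritical⇒noCutVertex G critical)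
  where
  oddL : Odd (k + 2 * l)
  oddL = proj₁ (proj₂ (L[G] (k + 2 * l)) (inj₂ refl))
  longest : ∀ m → Cycle G m → Odd m → m ≤ k + 2 * l
  longest m C odd with proj₁ (L[G] m) (odd , C)
  ... | inj₁ refl = m≤m+n k (2 * l)
  ... | inj₂ refl = ≤-refl
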